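{- There exists an infinite family of strings $w$, with lengths $n=|w|$ unbounded over the family, such that $r_{\$}(w^R)/r_{\$}(w)=\Omega(\log n)$.
   Context: Strings are over a finite totally ordered alphabet, compared lexicographically. For $w=w[1]\cdots w[n]$, $w^R=w[n]\cdots w[1]$. The Burrows–Wheeler transform ${\tt BWT}(s)$ of a string $s$ is obtained by sorting the multiset of all rotations $s[i\ldots|s|]s[1\ldots i-1]$ of $s$ lexicographically and concatenating their last characters. $r_{\$}(w)$ is the number of runs (maximal blocks of consecutive equal symbols) of ${\tt BWT}(w\$)$, where $\$$ is a fresh symbol smaller than all alphabet symbols. -}

module Defs where

open import Data.Nat using (ℕ; zero; suc; _<ᵇ_; _≡ᵇ_; _+_)
open import Data.Bool using (Bool; true; false; if_then_else_)
open import Data.List using (List; []; _∷_; _++_; map; drop; take; length; upTo; reverse; [_])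
open import Data.Fin using (Fin; toℕ)

-- The string w$ is encoded over ℕ: '$' ↦ 0, symbol a ↦ suc (toℕ a),
-- so '$' is strictly smaller than every alphabet symbol and the order is preserved.

rotate : {A : Set} → List A → ℕ → List A
rotate s i = drop i s ++ take i s

rotations : {A : Set} → List A → List (List A)
rotations s = map (rotate s) (upTo (length s))

lexLeq : List ℕ → List ℕ → Bool
lexLeq [] _ = true
lexLeq (x ∷ xs) [] = false
lexLeq (x ∷ xs) (y ∷ ys) =
  if x <ᵇ y then true else (if y <ᵇ x then false else lexLeq xs ys)

insertLex : List ℕ → List (List ℕ) → List (List ℕ)
insertLex u [] = u ∷ []
insertLex u (v ∷ vs) = if lexLeq u v then u ∷ v ∷ vs else v ∷ insertLex u vs

sortLex : List (List ℕ) → List (List ℕ)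
sortLex [] = []
sortLex (u ∷ us) = insertLex u (sortLex us)

-- last character (rotations are non-empty; default is irrelevant)
lastOr0 : List ℕ → ℕ
lastOr0 [] = 0
lastOr0 (x ∷ []) = x
lastOr0 (x ∷ y ∷ ys) = lastOr0 (y ∷ ys)

BWT : List ℕ → List ℕ
BWT s = map lastOr0 (sortLex (rotations s))

runsFrom : ℕ → List ℕ → ℕ
runsFrom x [] = 0
runsFrom x (y ∷ ys) = (if x ≡ᵇ y then 0 else 1) + runsFrom y ys

runs : List ℕ → ℕ
runs [] = 0
runs (x ∷ xs) = suc (runsFrom x xs)

withDollar : {σ : ℕ} → List (Fin σ) → List ℕ
withDollar w = map (λ a → suc (toℕ a)) w ++ [ 0 ]

r$ : {σ : ℕ} → List (Fin σ) → ℕ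
r$ w = runs (BWT (withDollar w))

-- Witnesses: the Fibonacci words f₀ = ab, f₁ = aba, f_{j+2} = f_{j+1} f_j, with |f_j| ≤ 2^{j+1}.
-- For odd j the sorted rotations of f_j$ form four consecutive blocks: $f_j, the rotations
-- ending with b, f_j$, and the rotations ending with a; so BWT(f_j$) has at most four runs.
-- The comparisons behind this, x$ < w$ whenever bx is a suffix of w and w$ < y$ whenever ay
-- is a suffix of w with y nonempty, hold for w = aba and are preserved by ψ : a ↦ aba, b ↦ ab,
-- which maps f_j to f_{j+2}.
-- For every m ≤ j, f_j begins with c_m t_m, where c_m is a central word and t_m is ab or ba
-- alternately. The rotations of (f_j)ᴿ$ beginning with (c_m)ᴿ$ increase with m and end
-- alternately with a and b, so BWT((f_j)ᴿ$) has at least j + 1 runs. Hence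
-- ⌊log₂ |f_j|⌋ · r$(f_j) ≤ 4 (j + 1) ≤ 4 r$((f_j)ᴿ).

module Submission where

open import Defs
open import Data.Bool using (true; false; if_then_else_)
open import Data.Bool.Properties using (T-≡)
open import Function.Bundles using (Equivalence)
open import Data.Fin using (Fin; toℕ)
open import Data.Fin.Properties using (toℕ-injective)
import Data.Fin as Fin
open import Data.List
  using (List; []; _∷_; _++_; [_]; last; map; length; reverse; drop; take; applyUpTo; initLast; _∷ʳ′_)
open import Data.List.Properties
  using ( ++-assoc; ++-identityʳ; ∷ʳ-++; map-++; map-∘; map-cong-local
        ; length-map; length-++; length-++-sucʳ; length-++-≤ˡ; length-take; length-applyUpTo
        ; take++drop≡id; reverse-++; unfold-reverse; ≡-dec)
open import Data.List.Membership.Propositional using (_∈_)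
open import Data.List.Membership.Propositional.Properties using (∈-map⁺; ∈-map⁻; ∈-upTo⁺; ∈-upTo⁻)
open import Data.List.Relation.Unary.Any using (here; there)
open import Data.List.Relation.Unary.All as All using (All; []; _∷_)
open import Data.List.Relation.Unary.AllPairs using (AllPairs; []; _∷_)
open import Data.List.Relation.Unary.Linked as Linked using (Linked; []; [-]; _∷_)
open import Data.List.Relation.Unary.Linked.Properties as Linkedₚ using (Linked⇒AllPairs)
import Data.List.Relation.Unary.All.Properties as Allₚ
open import Data.List.Relation.Binary.Sublist.Propositional using (_⊆_; []; _∷ʳ_; _∷_; minimum)
import Data.List.Relation.Binary.Sublist.Propositional.Properties as Sublist
open import Data.List.Relation.Binary.Permutation.Propositional
  using (_↭_; prep; swap; ↭-refl; ↭-trans; ↭-sym)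
open import Data.List.Relation.Binary.Permutation.Propositional.Properties using (∈-resp-↭)
open import Data.Nat
  using (ℕ; zero; suc; _+_; _*_; _∸_; _^_; _≤_; _<_; _≤′_; ≤′-refl; ≤′-step; _≡ᵇ_; z≤n; s≤s; z<s; s<s; s≤s⁻¹)
open import Data.Nat.Properties
open import Data.Nat.Logarithm using (⌊log₂_⌋; ⌊log₂⌋-mono-≤; ⌊log₂[2^n]⌋≡n)
open import Data.Maybe using (just)
open import Data.Product using (Σ; ∃; ∃₂; ∃-syntax; _×_; _,_; proj₁; proj₂)
open import Data.Sum using (inj₁; inj₂)
open import Function using (_∘_; _on_)
open import Relation.Binary using (tri<; tri≈; tri>)
open import Relation.Binary.PropositionalEquality hiding ([_])
open import Relation.Nullary using (¬_; yes; no; contradiction)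
open import Relation.Nullary.Reflects using (ofʸ; ofⁿ; det)

private
  variable
    x y : ℕ
    u v w : List ℕ
    xs ys : List ℕ

_≤ₗ_ : List ℕ → List ℕ → Set
u ≤ₗ v = lexLeq u v ≡ true

lexLeq-< : ∀ u v → x < y → lexLeq (x ∷ u) (y ∷ v) ≡ true
lexLeq-< {x} {y} u v x<y rewrite det (<ᵇ-reflects-< x y) (ofʸ x<y) = refl

lexLeq-> : ∀ u v → y < x → lexLeq (x ∷ u) (y ∷ v) ≡ false
lexLeq-> {y} {x} u v y<x
  rewrite det (<ᵇ-reflects-< x y) (ofⁿ (<⇒≯ y<x)) | det (<ᵇ-reflects-< y x) (ofʸ y<x) = refl

lexLeq-≡ : ∀ x u v → lexLeq (x ∷ u) (x ∷ v) ≡ lexLeq u v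
lexLeq-≡ x u v rewrite det (<ᵇ-reflects-< x x) (ofⁿ (<-irrefl refl)) = refl

lexLeq-total : ∀ u v → lexLeq u v ≡ false → v ≤ₗ u
lexLeq-total [] v ()
lexLeq-total (x ∷ u) [] _ = refl
lexLeq-total (x ∷ u) (y ∷ v) u≰v with <-cmp x y
... | tri< x<y _ _ = contradiction (trans (sym (lexLeq-< u v x<y)) u≰v) λ ()
... | tri≈ _ refl _ rewrite lexLeq-≡ x v u | lexLeq-≡ x u v = lexLeq-total u v u≰v
... | tri> _ _ y<x = lexLeq-< v u y<x

≤ₗ-trans : ∀ u v w → u ≤ₗ v → v ≤ₗ w → u ≤ₗ w
≤ₗ-trans [] _ _ _ _ = refl
≤ₗ-trans (x ∷ u) (y ∷ v) (z ∷ w) u≤v v≤w with <-cmp x y | <-cmp y z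
... | tri> _ _ y<x | _ = contradiction (trans (sym (lexLeq-> u v y<x)) u≤v) λ ()
... | _ | tri> _ _ z<y = contradiction (trans (sym (lexLeq-> v w z<y)) v≤w) λ ()
... | tri< x<y _ _ | tri< y<z _ _ = lexLeq-< u w (<-trans x<y y<z)
... | tri< x<y _ _ | tri≈ _ refl _ = lexLeq-< u w x<y
... | tri≈ _ refl _ | tri< y<z _ _ = lexLeq-< u w y<z
... | tri≈ _ refl _ | tri≈ _ refl _
  rewrite lexLeq-≡ x u v | lexLeq-≡ x v w | lexLeq-≡ x u w = ≤ₗ-trans u v w u≤v v≤w

-- Lexicographic order without the proper-prefix case, hence preserved by appending tails.
infix 4 _≺_

data _≺_ : List ℕ → List ℕ → Set where
  this : ∀ {x y u v} → x < y → x ∷ u ≺ y ∷ v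
  next : ∀ {x u v} → u ≺ v → x ∷ u ≺ x ∷ v

≺-trans : u ≺ v → v ≺ w → u ≺ w
≺-trans (this x<y) (this y<z) = this (<-trans x<y y<z)
≺-trans (this x<y) (next _)   = this x<y
≺-trans (next _)   (this y<z) = this y<z
≺-trans (next u≺v) (next v≺w) = next (≺-trans u≺v v≺w)

≺-irrefl : ¬ u ≺ u
≺-irrefl (this x<x) = <-irrefl refl x<x
≺-irrefl (next u≺u) = ≺-irrefl u≺u

≺-extendˡ : ∀ s → u ≺ v → u ++ s ≺ v
≺-extendˡ s (this x<y) = this x<y
≺-extendˡ s (next u≺v) = next (≺-extendˡ s u≺v)

≺-extendʳ : ∀ t → u ≺ v → u ≺ v ++ t
≺-extendʳ t (this x<y) = this x<y
≺-extendʳ t (next u≺v) = next (≺-extendʳ t u≺v)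

≺⇒lexLeq-false : u ≺ v → lexLeq v u ≡ false
≺⇒lexLeq-false (this {u = u} {v = v} x<y) = lexLeq-> v u x<y
≺⇒lexLeq-false (next {x = x} {u = u} {v = v} u≺v) = trans (lexLeq-≡ x v u) (≺⇒lexLeq-false u≺v)

≺⇒≱ₗ : u ≺ v → ¬ v ≤ₗ u
≺⇒≱ₗ u≺v v≤u with trans (sym (≺⇒lexLeq-false u≺v)) v≤u
... | ()

Sorted : List (List ℕ) → Set
Sorted = Linked _≤ₗ_

insertLex-after : ∀ v u vs → v ≤ₗ u → Sorted (v ∷ vs) → Sorted (v ∷ insertLex u vs)
insertLex-after v u []       v≤u _ = v≤u ∷ [-]
insertLex-after v u (w ∷ vs) v≤u (v≤w ∷ sorted) with lexLeq u w in u≤w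
... | true  = v≤u ∷ u≤w ∷ sorted
... | false = v≤w ∷ insertLex-after w u vs (lexLeq-total u w u≤w) sorted

insertLex-sorted : ∀ u vs → Sorted vs → Sorted (insertLex u vs)
insertLex-sorted u []       _ = [-]
insertLex-sorted u (v ∷ vs) sorted with lexLeq u v in u≤v
... | true  = u≤v ∷ sorted
... | false = insertLex-after v u vs (lexLeq-total u v u≤v) sorted

sortLex-sorted : ∀ us → Sorted (sortLex us)
sortLex-sorted []       = []
sortLex-sorted (u ∷ us) = insertLex-sorted u (sortLex us) (sortLex-sorted us)

insertLex-↭ : ∀ u vs → insertLex u vs ↭ u ∷ vs
insertLex-↭ u []       = ↭-refl
insertLex-↭ u (v ∷ vs) with lexLeq u v
... | true  = ↭-refl
... | false = ↭-trans (prep v (insertLex-↭ u vs)) (swap v u ↭-refl)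

sortLex-↭ : ∀ us → sortLex us ↭ us
sortLex-↭ []       = ↭-refl
sortLex-↭ (u ∷ us) = ↭-trans (insertLex-↭ u (sortLex us)) (prep u (sortLex-↭ us))

sorted-head-≤ : ∀ {v vs} → Sorted (v ∷ vs) → All (v ≤ₗ_) vs
sorted-head-≤ sorted with Linked⇒AllPairs (λ {u} {v} {w} → ≤ₗ-trans u v w) sorted
... | v≤vs ∷ _ = v≤vs

∈-tail : ∀ {A : Set} {x y : A} {ys} → x ∈ y ∷ ys → x ≢ y → x ∈ ys
∈-tail (here x≡y) x≢y = contradiction x≡y x≢y
∈-tail (there x∈ys) _ = x∈ys

increasing⇒⊆-sorted : ∀ {L ys} → Sorted L → AllPairs _≺_ ys → All (_∈ L) ys → ys ⊆ L
increasing⇒⊆-sorted {[]}    {[]}    _ _ _ = []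
increasing⇒⊆-sorted {[]}    {_ ∷ _} _ _ (() ∷ _)
increasing⇒⊆-sorted {v ∷ L} {[]}    _ _ _ = minimum (v ∷ L)
increasing⇒⊆-sorted {v ∷ L} {y ∷ ys} sorted (y≺ys ∷ chain) (y∈L ∷ ys∈L) with ≡-dec _≟_ y v
... | yes refl =
  refl ∷ increasing⇒⊆-sorted (Linked.tail sorted) chain (All.zipWith drop-head (y≺ys , ys∈L))
  where
  drop-head : ∀ {w} → y ≺ w × w ∈ y ∷ L → w ∈ L
  drop-head (y≺w , w∈L) = ∈-tail w∈L λ { refl → ≺-irrefl y≺w }
... | no y≢v = v ∷ʳ increasing⇒⊆-sorted (Linked.tail sorted) (y≺ys ∷ chain)
                  (∈-tail y∈L y≢v ∷ All.zipWith drop-head (y≺ys , ys∈L))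
  where
  v≤y : v ≤ₗ y
  v≤y = All.lookup (sorted-head-≤ sorted) (∈-tail y∈L y≢v)
  drop-head : ∀ {w} → y ≺ w × w ∈ v ∷ L → w ∈ L
  drop-head (y≺w , w∈L) = ∈-tail w∈L λ { refl → ≺⇒≱ₗ y≺w v≤y }

change : ℕ → ℕ → ℕ
change x y = if x ≡ᵇ y then 0 else 1

change≤1 : ∀ x y → change x y ≤ 1
change≤1 x y with x ≡ᵇ y
... | true  = z≤n
... | false = ≤-refl

change-refl : ∀ x → change x x ≡ 0
change-refl x rewrite Equivalence.to T-≡ (≡⇒≡ᵇ x x refl) = refl

change-≢ : x ≢ y → change x y ≡ 1
change-≢ {x} {y} x≢y with x ≡ᵇ y in x≡y
... | true  = contradiction (≡ᵇ⇒≡ x y (Equivalence.from T-≡ x≡y)) x≢y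
... | false = refl

change-triangle : ∀ x y z → change x z ≤ change x y + change y z
change-triangle x y z with x ≡ᵇ y in x≡y | y ≡ᵇ z in y≡z
... | false | _     = ≤-trans (change≤1 x z) (s≤s z≤n)
... | true  | false = change≤1 x z
... | true  | true
  rewrite ≡ᵇ⇒≡ x y (Equivalence.from T-≡ x≡y) | ≡ᵇ⇒≡ y z (Equivalence.from T-≡ y≡z) =
    ≤-reflexive (change-refl z)

runsFrom-∷ : ∀ z y ys → runsFrom z ys ≤ runsFrom z (y ∷ ys)
runsFrom-∷ z y []       = z≤n
runsFrom-∷ z y (w ∷ ws) = begin
  change z w + runsFrom w ws                ≤⟨ +-monoˡ-≤ (runsFrom w ws) (change-triangle z y w) ⟩
  change z y + change y w + runsFrom w ws   ≡⟨ +-assoc (change z y) (change y w) (runsFrom w ws) ⟩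
  change z y + (change y w + runsFrom w ws) ∎
  where open ≤-Reasoning

runs-∷ : ∀ y ys → runs ys ≤ runs (y ∷ ys)
runs-∷ y []       = z≤n
runs-∷ y (w ∷ ws) = s≤s (m≤n+m (runsFrom w ws) (change y w))

runsFrom-mono-⊆ : ∀ z → xs ⊆ ys → runsFrom z xs ≤ runsFrom z ys
runsFrom-mono-⊆ z []                        = z≤n
runsFrom-mono-⊆ z (_∷ʳ_ {ys = ys} y xs⊆ys) = ≤-trans (runsFrom-mono-⊆ z xs⊆ys) (runsFrom-∷ z y ys)
runsFrom-mono-⊆ z (refl ∷ xs⊆ys)            = +-monoʳ-≤ (change z _) (runsFrom-mono-⊆ _ xs⊆ys)

runs-mono-⊆ : xs ⊆ ys → runs xs ≤ runs ys
runs-mono-⊆ []                        = z≤n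
runs-mono-⊆ (_∷ʳ_ {ys = ys} y xs⊆ys) = ≤-trans (runs-mono-⊆ xs⊆ys) (runs-∷ y ys)
runs-mono-⊆ (refl ∷ xs⊆ys)            = s≤s (runsFrom-mono-⊆ _ xs⊆ys)

runsFrom-alternating : Linked _≢_ (x ∷ xs) → runsFrom x xs ≡ length xs
runsFrom-alternating [-]               = refl
runsFrom-alternating (x≢y ∷ alternate) = cong₂ _+_ (change-≢ x≢y) (runsFrom-alternating alternate)

runs-alternating : Linked _≢_ xs → runs xs ≡ length xs
runs-alternating []                = refl
runs-alternating [-]               = refl
runs-alternating alternate@(_ ∷ _) = cong suc (runsFrom-alternating alternate)

runsFrom-map-monotone : ∀ (h : ℕ → ℕ) {k n ns} → Linked _≤_ (n ∷ ns) → All (_≤ k) ns →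
                        runsFrom (h n) (map h ns) ≤ k ∸ n
runsFrom-map-monotone h [-] [] = z≤n
runsFrom-map-monotone h {k} {n} {m ∷ ns} (n≤m ∷ monotone) (m≤k ∷ bounded)
  with m≤n⇒m<n∨m≡n n≤m
... | inj₂ refl rewrite change-refl (h n) = runsFrom-map-monotone h monotone bounded
... | inj₁ n<m = begin
  change (h n) (h m) + runsFrom (h m) (map h ns) ≤⟨ +-mono-≤ (change≤1 (h n) (h m))
                                                             (runsFrom-map-monotone h monotone bounded) ⟩
  suc (k ∸ m)                                    ≤⟨ ∸-monoʳ-< n<m m≤k ⟩
  k ∸ n                                          ∎
  where open ≤-Reasoning

runs-map-monotone : ∀ (h : ℕ → ℕ) {k ns} → Linked _≤_ ns → All (_≤ k) ns → runs (map h ns) ≤ suc k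
runs-map-monotone h []                       []            = z≤n
runs-map-monotone h {k} {n ∷ _} monotone (_ ∷ bounded) =
  s≤s (≤-trans (runsFrom-map-monotone h monotone bounded) (m∸n≤m k n))

∈-sortLex⁻ : ∀ {x} us → x ∈ sortLex us → x ∈ us
∈-sortLex⁻ us = ∈-resp-↭ (sortLex-↭ us)

∈-sortLex⁺ : ∀ {x} us → x ∈ us → x ∈ sortLex us
∈-sortLex⁺ us = ∈-resp-↭ (↭-sym (sortLex-↭ us))

sorted⇒keys-monotone : ∀ {P : List ℕ → Set} (key : List ℕ → ℕ) →
                       (∀ {x y} → P x → P y → key y < key x → y ≺ x) →
                       ∀ {L} → Sorted L → All P L → Linked (_≤_ on key) L
sorted⇒keys-monotone key separated []             _              = []
sorted⇒keys-monotone key separated [-]            _              = [-]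
sorted⇒keys-monotone key separated (x≤y ∷ sorted) (px ∷ py ∷ ps) =
  ≮⇒≥ (λ y<x → ≺⇒≱ₗ (separated px py y<x) x≤y) ∷
  sorted⇒keys-monotone key separated sorted (py ∷ ps)

runs-BWT-≤ : ∀ (key : List ℕ → ℕ) (h : ℕ → ℕ) k s →
             (∀ {x} → x ∈ rotations s → key x ≤ k × lastOr0 x ≡ h (key x)) →
             (∀ {x y} → x ∈ rotations s → y ∈ rotations s → key y < key x → y ≺ x) →
             runs (BWT s) ≤ suc k
runs-BWT-≤ key h k s blocks separated = begin
  runs (map lastOr0 L)     ≡⟨ cong runs (trans (map-cong-local (All.map (proj₂ ∘ blocks) rotation))
                                                (map-∘ L)) ⟩
  runs (map h (map key L)) ≤⟨ runs-map-monotone h keys-sorted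
                                (Allₚ.map⁺ (All.map (proj₁ ∘ blocks) rotation)) ⟩
  suc k                    ∎
  where
  open ≤-Reasoning
  L = sortLex (rotations s)
  rotation : All (_∈ rotations s) L
  rotation = All.tabulate (∈-sortLex⁻ (rotations s))
  keys-sorted : Linked _≤_ (map key L)
  keys-sorted =
    Linkedₚ.map⁺ (sorted⇒keys-monotone key separated (sortLex-sorted (rotations s)) rotation)

runs-BWT-≥ : ∀ s ys → AllPairs _≺_ ys → All (_∈ rotations s) ys → Linked (_≢_ on lastOr0) ys →
             length ys ≤ runs (BWT s)
runs-BWT-≥ s ys increasing rotation alternating = begin
  length ys                ≡⟨ sym (length-map lastOr0 ys) ⟩
  length (map lastOr0 ys)  ≡⟨ sym (runs-alternating (Linkedₚ.map⁺ alternating)) ⟩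
  runs (map lastOr0 ys)    ≤⟨ runs-mono-⊆ (Sublist.map⁺ lastOr0 ys⊆L) ⟩
  runs (BWT s)             ∎
  where
  open ≤-Reasoning
  ys⊆L : ys ⊆ sortLex (rotations s)
  ys⊆L = increasing⇒⊆-sorted (sortLex-sorted (rotations s)) increasing
           (All.map (∈-sortLex⁺ (rotations s)) rotation)

code : ∀ {σ} → List (Fin σ) → List ℕ
code = map (λ c → suc (toℕ c))

module _ {A : Set} where

  drop-length-++ : ∀ (u v : List A) → drop (length u) (u ++ v) ≡ v
  drop-length-++ []      v = refl
  drop-length-++ (_ ∷ u) v = drop-length-++ u v

  take-length-++ : ∀ (u v : List A) → take (length u) (u ++ v) ≡ u
  take-length-++ []      v = refl
  take-length-++ (x ∷ u) v = cong (x ∷_) (take-length-++ u v)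

  rotate-++ : ∀ (u v : List A) → rotate (u ++ v) (length u) ≡ v ++ u
  rotate-++ u v = cong₂ _++_ (drop-length-++ u v) (take-length-++ u v)

  ++-∈-rotations : ∀ (u : List A) x v → (x ∷ v) ++ u ∈ rotations (u ++ x ∷ v)
  ++-∈-rotations u x v = subst (_∈ rotations (u ++ x ∷ v)) (rotate-++ u (x ∷ v))
    (∈-map⁺ (rotate (u ++ x ∷ v))
      (∈-upTo⁺ (subst (length u <_) (sym (length-++-sucʳ u x v)) (s≤s (length-++-≤ˡ u)))))

withDollar-++ : ∀ {σ} (p q : List (Fin σ)) → withDollar (p ++ q) ≡ code p ++ withDollar q
withDollar-++ p q = trans (cong (_++ [ 0 ]) (map-++ _ p q)) (++-assoc (code p) (code q) [ 0 ])

length-withDollar : ∀ {σ} (w : List (Fin σ)) → length (withDollar w) ≡ suc (length w)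
length-withDollar w =
  trans (length-++ (code w)) (trans (+-comm (length (code w)) 1) (cong suc (length-map _ w)))

∈-rotations-withDollar⁺ : ∀ {σ} {w} (p q : List (Fin σ)) → w ≡ p ++ q →
                          withDollar q ++ code p ∈ rotations (withDollar w)
∈-rotations-withDollar⁺ p []      refl rewrite withDollar-++ p [] = ++-∈-rotations (code p) 0 []
∈-rotations-withDollar⁺ p (c ∷ q) refl rewrite withDollar-++ p (c ∷ q) =
  ++-∈-rotations (code p) (suc (toℕ c)) (withDollar q)

∈-rotations-withDollar⁻ : ∀ {σ} {x} (w : List (Fin σ)) → x ∈ rotations (withDollar w) →
                          ∃₂ λ p q → w ≡ p ++ q × x ≡ withDollar q ++ code p
∈-rotations-withDollar⁻ w x∈ with ∈-map⁻ (rotate (withDollar w)) x∈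
... | i , i∈ , refl = p , q , sym (take++drop≡id i w) , (begin
  rotate (withDollar w) i
    ≡⟨ cong₂ rotate (cong withDollar (sym (take++drop≡id i w))) i≡∣p∣ ⟩
  rotate (withDollar (p ++ q)) (length (code p))
    ≡⟨ cong (λ s → rotate s (length (code p))) (withDollar-++ p q) ⟩
  rotate (code p ++ withDollar q) (length (code p))
    ≡⟨ rotate-++ (code p) (withDollar q) ⟩
  withDollar q ++ code p
    ∎)
  where
  open ≡-Reasoning
  p = take i w
  q = drop i w
  i≤∣w∣ : i ≤ length w
  i≤∣w∣ = ≤-pred (subst (i <_) (length-withDollar w) (∈-upTo⁻ i∈))
  i≡∣p∣ : i ≡ length (code p)
  i≡∣p∣ = sym (trans (length-map _ p) (trans (length-take i w) (m≤n⇒m⊓n≡m i≤∣w∣)))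

lastOr0-∷ʳ : ∀ xs y → lastOr0 (xs ++ [ y ]) ≡ y
lastOr0-∷ʳ []           y = refl
lastOr0-∷ʳ (_ ∷ [])     y = refl
lastOr0-∷ʳ (_ ∷ x ∷ xs) y = lastOr0-∷ʳ (x ∷ xs) y

lastOr0-++-code : ∀ {σ} xs (p : List (Fin σ)) c → lastOr0 (xs ++ code (p ++ [ c ])) ≡ suc (toℕ c)
lastOr0-++-code xs p c = begin
  lastOr0 (xs ++ code (p ++ [ c ]))          ≡⟨ cong (λ t → lastOr0 (xs ++ t)) (map-++ _ p [ c ]) ⟩
  lastOr0 (xs ++ code p ++ [ suc (toℕ c) ])  ≡⟨ cong lastOr0 (sym (++-assoc xs (code p) _)) ⟩
  lastOr0 ((xs ++ code p) ++ [ suc (toℕ c) ]) ≡⟨ lastOr0-∷ʳ (xs ++ code p) _ ⟩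
  suc (toℕ c)                                ∎
  where open ≡-Reasoning

lastOr0-∷-code : ∀ {σ} {c} x (w : List (Fin σ)) → last w ≡ just c →
                 lastOr0 (x ∷ code w) ≡ suc (toℕ c)
lastOr0-∷-code x (_ ∷ [])    refl   = refl
lastOr0-∷-code x (d ∷ e ∷ w) last≡c = lastOr0-∷-code (suc (toℕ d)) (e ∷ w) last≡c

-- Clustered words over {a, b}

pattern a = Fin.zero
pattern b = Fin.suc Fin.zero

data Suffix {A : Set} (z : List A) : List A → Set where
  done : Suffix z z
  skip : ∀ {c w} → Suffix z w → Suffix z (c ∷ w)

suffix-++ : ∀ {A : Set} (p z : List A) → Suffix z (p ++ z)
suffix-++ []      z = done
suffix-++ (_ ∷ p) z = skip (suffix-++ p z)

last-suffix : ∀ {A : Set} {c : A} {x w} → Suffix (c ∷ x) w → last (c ∷ x) ≡ last w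
last-suffix done                  = refl
last-suffix (skip {w = _ ∷ _} s) = last-suffix s

-- u ⊏ v iff u$ < v$, for words over {a, b}.
infix 4 _⊏_

data _⊏_ : List (Fin 2) → List (Fin 2) → Set where
  halt : ∀ {c v} → [] ⊏ c ∷ v
  a<b  : ∀ {u v} → a ∷ u ⊏ b ∷ v
  next : ∀ {c u v} → u ⊏ v → c ∷ u ⊏ c ∷ v

⊏⇒≺ : ∀ {u v} → u ⊏ v → withDollar u ≺ withDollar v
⊏⇒≺ halt       = this z<s
⊏⇒≺ a<b        = this (s<s z<s)
⊏⇒≺ (next u⊏v) = next (⊏⇒≺ u⊏v)

record Clustered (w : List (Fin 2)) : Set where
  field
    ends-with-a : last w ≡ just a
    below-after-b : ∀ {x} → Suffix (b ∷ x) w → x ⊏ w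
    above-after-a : ∀ {c x} → Suffix (a ∷ c ∷ x) w → w ⊏ c ∷ x

data Rotation (w : List (Fin 2)) : List ℕ → Set where
  starts-with-$ : Rotation w (0 ∷ code w)
  preceded-by-b : ∀ {c q} (p : List (Fin 2)) → Suffix (b ∷ c ∷ q) w →
                  Rotation w (withDollar (c ∷ q) ++ code (p ++ [ b ]))
  ends-with-$   : ∀ {c q} → w ≡ c ∷ q → Rotation w (withDollar w)
  preceded-by-a : ∀ {c q} (p : List (Fin 2)) → Suffix (a ∷ c ∷ q) w →
                  Rotation w (withDollar (c ∷ q) ++ code (p ++ [ a ]))

rotation-shape : ∀ {w x} → x ∈ rotations (withDollar w) → Rotation w x
rotation-shape {w} x∈ with ∈-rotations-withDollar⁻ w x∈
... | p , []    , refl , refl =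
  subst (λ w → Rotation w (0 ∷ code p)) (sym (++-identityʳ p)) starts-with-$
... | p , c ∷ q , refl , refl with initLast p
...   | []         = subst (Rotation (c ∷ q)) (sym (++-identityʳ _)) (ends-with-$ refl)
...   | p′ ∷ʳ′ a   = preceded-by-a p′ (subst (Suffix _) (sym (∷ʳ-++ p′ _ _)) (suffix-++ p′ _))
...   | p′ ∷ʳ′ b   = preceded-by-b p′ (subst (Suffix _) (sym (∷ʳ-++ p′ _ _)) (suffix-++ p′ _))

rank : ∀ {w x} → Rotation w x → ℕ
rank starts-with-$       = 0
rank (preceded-by-b _ _) = 1
rank (ends-with-$ _)     = 2
rank (preceded-by-a _ _) = 3

rank≤3 : ∀ {w x} (r : Rotation w x) → rank r ≤ 3
rank≤3 starts-with-$       = z≤n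
rank≤3 (preceded-by-b _ _) = s≤s z≤n
rank≤3 (ends-with-$ _)     = s≤s (s≤s z≤n)
rank≤3 (preceded-by-a _ _) = ≤-refl

-- A rotation starting with $ has rank 0; otherwise its last symbol b, $, a gives rank 1, 2, 3.
blockOfLast : ℕ → ℕ
blockOfLast 0 = 2
blockOfLast 2 = 1
blockOfLast _ = 3

block : List ℕ → ℕ
block (zero ∷ _) = 0
block x          = blockOfLast (lastOr0 x)

lastOfBlock : ℕ → ℕ
lastOfBlock 1 = 2
lastOfBlock 2 = 0
lastOfBlock _ = 1

block-rank : ∀ {w x} (r : Rotation w x) → block x ≡ rank r
block-rank starts-with-$               = refl
block-rank (preceded-by-b {c} {q} p _) = cong blockOfLast (lastOr0-++-code (withDollar (c ∷ q)) p b)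
block-rank (ends-with-$ {c} {q} refl)  = cong blockOfLast (lastOr0-∷ʳ (code (c ∷ q)) 0)
block-rank (preceded-by-a {c} {q} p _) = cong blockOfLast (lastOr0-++-code (withDollar (c ∷ q)) p a)

lastOr0-rank : ∀ {w x} → last w ≡ just a → (r : Rotation w x) → lastOr0 x ≡ lastOfBlock (rank r)
lastOr0-rank {w} ends-with-a starts-with-$ = lastOr0-∷-code 0 w ends-with-a
lastOr0-rank _ (preceded-by-b {c} {q} p _) = lastOr0-++-code (withDollar (c ∷ q)) p b
lastOr0-rank _ (ends-with-$ {c} {q} refl)  = lastOr0-∷ʳ (code (c ∷ q)) 0
lastOr0-rank _ (preceded-by-a {c} {q} p _) = lastOr0-++-code (withDollar (c ∷ q)) p a

rank-≺ : ∀ {w x y} → Clustered w → (rx : Rotation w x) (ry : Rotation w y) →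
         rank ry < rank rx → y ≺ x
rank-≺ _ (preceded-by-b _ _) starts-with-$ _ = this z<s
rank-≺ _ (ends-with-$ refl)  starts-with-$ _ = this z<s
rank-≺ _ (preceded-by-a _ _) starts-with-$ _ = this z<s
rank-≺ C (ends-with-$ refl) (preceded-by-b _ s) _ =
  ≺-extendˡ _ (⊏⇒≺ (Clustered.below-after-b C s))
rank-≺ C (preceded-by-a _ s′) (preceded-by-b _ s) _ =
  ≺-extendˡ _ (≺-extendʳ _ (≺-trans (⊏⇒≺ (Clustered.below-after-b C s))
                                    (⊏⇒≺ (Clustered.above-after-a C s′))))
rank-≺ C (preceded-by-a _ s′) (ends-with-$ refl) _ = ≺-extendʳ _ (⊏⇒≺ (Clustered.above-after-a C s′))
rank-≺ _ starts-with-$       starts-with-$       ()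
rank-≺ _ starts-with-$       (preceded-by-b _ _) ()
rank-≺ _ (preceded-by-b _ _) (preceded-by-b _ _) (s≤s ())
rank-≺ _ starts-with-$       (ends-with-$ _)     ()
rank-≺ _ (preceded-by-b _ _) (ends-with-$ _)     (s≤s ())
rank-≺ _ (ends-with-$ _)     (ends-with-$ _)     (s≤s (s≤s ()))
rank-≺ _ rx                  (preceded-by-a _ _) 3<r = contradiction (rank≤3 rx) (<⇒≱ 3<r)

r$-clustered : ∀ {w} → Clustered w → r$ w ≤ 4
r$-clustered {w} C = runs-BWT-≤ block lastOfBlock 3 (withDollar w) blocks separated
  where
  blocks : ∀ {x} → x ∈ rotations (withDollar w) → block x ≤ 3 × lastOr0 x ≡ lastOfBlock (block x)
  blocks x∈ rewrite block-rank (rotation-shape x∈) =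
    rank≤3 (rotation-shape x∈) , lastOr0-rank (Clustered.ends-with-a C) (rotation-shape x∈)
  separated : ∀ {x y} → x ∈ rotations (withDollar w) → y ∈ rotations (withDollar w) →
              block y < block x → y ≺ x
  separated x∈ y∈ rewrite block-rank (rotation-shape x∈) | block-rank (rotation-shape y∈) =
    rank-≺ C (rotation-shape x∈) (rotation-shape y∈)

-- The square of the Fibonacci morphism a ↦ ab, b ↦ a.
ψ : List (Fin 2) → List (Fin 2)
ψ []      = []
ψ (a ∷ w) = a ∷ b ∷ a ∷ ψ w
ψ (b ∷ w) = a ∷ b ∷ ψ w

ψ-++ : ∀ u v → ψ (u ++ v) ≡ ψ u ++ ψ v
ψ-++ []      v = refl
ψ-++ (a ∷ u) v = cong (λ t → a ∷ b ∷ a ∷ t) (ψ-++ u v)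
ψ-++ (b ∷ u) v = cong (λ t → a ∷ b ∷ t) (ψ-++ u v)

last-ψ-∷∷ : ∀ c d w → last (ψ (c ∷ d ∷ w)) ≡ last (ψ (d ∷ w))
last-ψ-∷∷ a a w = refl
last-ψ-∷∷ a b w = refl
last-ψ-∷∷ b a w = refl
last-ψ-∷∷ b b w = refl

last-ψ : ∀ w → last w ≡ just a → last (ψ w) ≡ just a
last-ψ (a ∷ [])    _      = refl
last-ψ (c ∷ d ∷ w) last≡a = trans (last-ψ-∷∷ c d w) (last-ψ (d ∷ w) last≡a)

ψ-⊏-b∷ : ∀ u v → ψ u ⊏ b ∷ v
ψ-⊏-b∷ []      v = halt
ψ-⊏-b∷ (a ∷ u) v = a<b
ψ-⊏-b∷ (b ∷ u) v = a<b

-- ψ a = aba ⊐ ab = ψ b, so the first difference must not be at the last letter of v.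
ψ-mono-⊏ : ∀ {u v} → u ⊏ v → last v ≡ just a → ψ u ⊏ ψ v
ψ-mono-⊏ (halt {a}) _ = halt
ψ-mono-⊏ (halt {b}) _ = halt
ψ-mono-⊏ (a<b {u} {a ∷ v}) _ = next (next (next (ψ-⊏-b∷ u (a ∷ ψ v))))
ψ-mono-⊏ (a<b {u} {b ∷ v}) _ = next (next (next (ψ-⊏-b∷ u (ψ v))))
ψ-mono-⊏ (next {a} {v = _ ∷ _} u⊏v) last≡a = next (next (next (ψ-mono-⊏ u⊏v last≡a)))
ψ-mono-⊏ (next {b} {v = _ ∷ _} u⊏v) last≡a = next (next (ψ-mono-⊏ u⊏v last≡a))

-- A suffix of ψ w is the image of a suffix y of w, or begins inside the image (aba or ab)
-- of the letter just before y.
data SuffixOfψ (w z : List (Fin 2)) : Set where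
  image       : ∀ y → z ≡ ψ y         → Suffix y w       → SuffixOfψ w z
  inside-a-ba : ∀ y → z ≡ b ∷ a ∷ ψ y → Suffix (a ∷ y) w → SuffixOfψ w z
  inside-a-a  : ∀ y → z ≡ a ∷ ψ y     → Suffix (a ∷ y) w → SuffixOfψ w z
  inside-b-b  : ∀ y → z ≡ b ∷ ψ y     → Suffix (b ∷ y) w → SuffixOfψ w z

SuffixOfψ-skip : ∀ {w z c} → SuffixOfψ w z → SuffixOfψ (c ∷ w) z
SuffixOfψ-skip (image y e s)       = image y e (skip s)
SuffixOfψ-skip (inside-a-ba y e s) = inside-a-ba y e (skip s)
SuffixOfψ-skip (inside-a-a y e s)  = inside-a-a y e (skip s)
SuffixOfψ-skip (inside-b-b y e s)  = inside-b-b y e (skip s)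

suffix-ψ : ∀ {z} w → Suffix z (ψ w) → SuffixOfψ w z
suffix-ψ []      done                   = image [] refl done
suffix-ψ (a ∷ w) done                   = image (a ∷ w) refl done
suffix-ψ (a ∷ w) (skip done)            = inside-a-ba w refl done
suffix-ψ (a ∷ w) (skip (skip done))     = inside-a-a w refl done
suffix-ψ (a ∷ w) (skip (skip (skip s))) = SuffixOfψ-skip (suffix-ψ w s)
suffix-ψ (b ∷ w) done                   = image (b ∷ w) refl done
suffix-ψ (b ∷ w) (skip done)            = inside-b-b w refl done
suffix-ψ (b ∷ w) (skip (skip s))        = SuffixOfψ-skip (suffix-ψ w s)

a∷ψ-⊏-ψ∷ : ∀ y c w → a ∷ ψ y ⊏ ψ (c ∷ w)
a∷ψ-⊏-ψ∷ y a w = next (ψ-⊏-b∷ y (a ∷ ψ w))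
a∷ψ-⊏-ψ∷ y b w = next (ψ-⊏-b∷ y (ψ w))

clustered-ψ : ∀ w → Clustered w → Clustered (ψ w)
clustered-ψ []          C = contradiction (Clustered.ends-with-a C) λ ()
clustered-ψ w@(c ∷ w′) C = record
  { ends-with-a   = last-ψ w ends-with-a
  ; below-after-b = λ s → below (suffix-ψ w s)
  ; above-after-a = λ s → above (suffix-ψ w s)
  }
  where
  open Clustered C
  below : ∀ {x} → SuffixOfψ w (b ∷ x) → x ⊏ ψ w
  below (image (a ∷ _) () _)
  below (image (b ∷ _) () _)
  below (inside-a-ba y refl _) = a∷ψ-⊏-ψ∷ y c w′
  below (inside-b-b y refl s) = ψ-mono-⊏ (below-after-b s) ends-with-a
  above : ∀ {c x} → SuffixOfψ w (a ∷ c ∷ x) → ψ w ⊏ c ∷ x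
  above (image (a ∷ y) refl _) = ψ-⊏-b∷ w _
  above (image (b ∷ y) refl _) = ψ-⊏-b∷ w _
  above (inside-a-a (a ∷ y) refl s) = ψ-mono-⊏ (above-after-a s) (trans (last-suffix s) ends-with-a)
  above (inside-a-a (b ∷ y) refl s) = ψ-mono-⊏ (above-after-a s) (trans (last-suffix s) ends-with-a)

fibWord : ℕ → List (Fin 2)
fibWord 0             = a ∷ b ∷ []
fibWord 1             = a ∷ b ∷ a ∷ []
fibWord (suc (suc j)) = fibWord (suc j) ++ fibWord j

ψ-fibWord : ∀ j → ψ (fibWord j) ≡ fibWord (2 + j)
ψ-fibWord 0             = refl
ψ-fibWord 1             = refl
ψ-fibWord (suc (suc j)) =
  trans (ψ-++ (fibWord (suc j)) (fibWord j)) (cong₂ _++_ (ψ-fibWord (suc j)) (ψ-fibWord j))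

clustered-aba : Clustered (a ∷ b ∷ a ∷ [])
clustered-aba = record
  { ends-with-a   = refl
  ; below-after-b = λ { (skip done) → next halt ; (skip (skip (skip ()))) }
  ; above-after-a = λ { done → a<b ; (skip (skip (skip ()))) }
  }

-- Even-indexed Fibonacci words end with b.
clustered-fibWord-odd : ∀ K → Clustered (fibWord (1 + 2 * K))
clustered-fibWord-odd zero    = clustered-aba
clustered-fibWord-odd (suc K) =
  subst (λ n → Clustered (fibWord (suc n))) (sym (*-suc 2 K))
    (subst Clustered (ψ-fibWord (1 + 2 * K)) (clustered-ψ _ (clustered-fibWord-odd K)))

-- Central words

alt : ℕ → Fin 2
alt 0             = a
alt 1             = b
alt (suc (suc m)) = alt m

alt-≢ : ∀ m → alt m ≢ alt (suc m)
alt-≢ 0             = λ ()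
alt-≢ 1             = λ ()
alt-≢ (suc (suc m)) = alt-≢ m

central : ℕ → List (Fin 2)
central 0             = []
central 1             = a ∷ []
central (suc (suc j)) = central (suc j) ++ alt (suc j) ∷ alt j ∷ central j

fibWord-central : ∀ j → fibWord j ≡ central j ++ alt j ∷ alt (suc j) ∷ []
fibWord-central 0             = refl
fibWord-central 1             = refl
fibWord-central (suc (suc j)) = begin
  fibWord (suc j) ++ fibWord j
    ≡⟨ cong₂ _++_ (fibWord-central (suc j)) (fibWord-central j) ⟩
  (central (suc j) ++ alt (suc j) ∷ alt j ∷ []) ++ central j ++ ends
    ≡⟨ ++-assoc (central (suc j)) (alt (suc j) ∷ alt j ∷ []) (central j ++ ends) ⟩
  central (suc j) ++ alt (suc j) ∷ alt j ∷ central j ++ ends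
    ≡⟨ sym (++-assoc (central (suc j)) (alt (suc j) ∷ alt j ∷ central j) ends) ⟩
  central (suc (suc j)) ++ ends
    ∎
  where
  open ≡-Reasoning
  ends = alt j ∷ alt (suc j) ∷ []

central-swap : ∀ j → central (suc (suc j)) ≡ central j ++ alt j ∷ alt (suc j) ∷ central (suc j)
central-swap 0       = refl
central-swap (suc j) =
  trans (++-assoc (central (suc j)) (alt (suc j) ∷ alt j ∷ central j) _)
        (cong (λ t → central (suc j) ++ alt (suc j) ∷ alt j ∷ t) (sym (central-swap j)))

central-suffix : ∀ m → ∃₂ λ y c → central (suc m) ≡ y ++ c ∷ central m
central-suffix 0       = [] , a , refl
central-suffix (suc m) = central m ++ [ alt m ] , alt (suc m) ,
  trans (central-swap m) (sym (∷ʳ-++ (central m) (alt m) _))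

fibWord-step : ∀ j → ∃ λ r → fibWord (suc j) ≡ fibWord j ++ r
fibWord-step 0       = a ∷ [] , refl
fibWord-step (suc j) = fibWord j , refl

fibWord-prefix : ∀ {m n} → m ≤′ n → ∃ λ r → fibWord n ≡ fibWord m ++ r
fibWord-prefix ≤′-refl = [] , sym (++-identityʳ _)
fibWord-prefix {m} (≤′-step {n} m≤n) with fibWord-prefix m≤n | fibWord-step n
... | r , n≡m++r | r′ , sn≡n++r′ =
  r ++ r′ , trans sn≡n++r′ (trans (cong (_++ r′) n≡m++r) (++-assoc (fibWord m) r r′))

central-prefix : ∀ {m N} → m ≤ N → ∃ λ R → fibWord N ≡ central m ++ alt m ∷ R
central-prefix {m} m≤N with fibWord-prefix (≤⇒≤′ m≤N)
... | r , N≡m++r = alt (suc m) ∷ r ,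
  trans N≡m++r (trans (cong (_++ r) (fibWord-central m)) (++-assoc (central m) _ r))

reverse-++-∷ : ∀ {A : Set} (y : List A) c u → reverse (y ++ c ∷ u) ≡ reverse u ++ c ∷ reverse y
reverse-++-∷ y c u = begin
  reverse (y ++ c ∷ u)             ≡⟨ reverse-++ y (c ∷ u) ⟩
  reverse (c ∷ u) ++ reverse y     ≡⟨ cong (_++ reverse y) (unfold-reverse c u) ⟩
  (reverse u ++ [ c ]) ++ reverse y ≡⟨ ∷ʳ-++ (reverse u) c (reverse y) ⟩
  reverse u ++ c ∷ reverse y       ∎
  where open ≡-Reasoning

withDollar-prefix-≺ : ∀ {σ} (u : List (Fin σ)) c t → withDollar u ≺ withDollar (u ++ c ∷ t)
withDollar-prefix-≺ []      c t = this z<s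
withDollar-prefix-≺ (_ ∷ u) c t = next (withDollar-prefix-≺ u c t)

-- For m ≤ N: the rotation of (reverse (fibWord N))$ that begins with (reverse (central m))$.
centralRotation : ℕ → ℕ → List ℕ
centralRotation N m =
  withDollar (reverse (central m)) ++ code (reverse (drop (length (central m)) (fibWord N)))

centralRotation-≡ : ∀ N m {z} → fibWord N ≡ central m ++ z →
                    centralRotation N m ≡ withDollar (reverse (central m)) ++ code (reverse z)
centralRotation-≡ N m {z} N≡m++z rewrite N≡m++z =
  cong (λ t → withDollar (reverse (central m)) ++ code (reverse t)) (drop-length-++ (central m) z)

centralRotation-∈ : ∀ {m N} → m ≤ N →
                    centralRotation N m ∈ rotations (withDollar (reverse (fibWord N)))
centralRotation-∈ {m} {N} m≤N with central-prefix m≤N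
... | R , N≡m++R = subst (_∈ rotations _) (sym (centralRotation-≡ N m N≡m++R))
  (∈-rotations-withDollar⁺ (reverse (alt m ∷ R)) (reverse (central m))
    (trans (cong reverse N≡m++R) (reverse-++ (central m) (alt m ∷ R))))

lastOr0-centralRotation : ∀ {m N} → m ≤ N → lastOr0 (centralRotation N m) ≡ suc (toℕ (alt m))
lastOr0-centralRotation {m} {N} m≤N with central-prefix m≤N
... | R , N≡m++R = begin
  lastOr0 (centralRotation N m)
    ≡⟨ cong lastOr0 (centralRotation-≡ N m N≡m++R) ⟩
  lastOr0 (prefix ++ code (reverse (alt m ∷ R)))
    ≡⟨ cong (λ t → lastOr0 (prefix ++ code t)) (unfold-reverse (alt m) R) ⟩
  lastOr0 (prefix ++ code (reverse R ++ [ alt m ]))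
    ≡⟨ lastOr0-++-code prefix (reverse R) (alt m) ⟩
  suc (toℕ (alt m))
    ∎
  where
  open ≡-Reasoning
  prefix = withDollar (reverse (central m))

centralRotation-≺ : ∀ {m N} → m < N → centralRotation N m ≺ centralRotation N (suc m)
centralRotation-≺ {m} {N} m<N with central-prefix (<⇒≤ m<N) | central-prefix m<N | central-suffix m
... | R , N≡m++R | R′ , N≡sm++R′ | y , c , sm≡y++c++m =
  subst₂ _≺_ (sym (centralRotation-≡ N m N≡m++R)) (sym (centralRotation-≡ N (suc m) N≡sm++R′))
    (≺-extendˡ (code (reverse (alt m ∷ R)))
      (≺-extendʳ (code (reverse (alt (suc m) ∷ R′))) prefix≺))
  where
  prefix≺ : withDollar (reverse (central m)) ≺ withDollar (reverse (central (suc m)))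
  prefix≺ = subst (λ v → withDollar (reverse (central m)) ≺ withDollar v)
    (sym (trans (cong reverse sm≡y++c++m) (reverse-++-∷ y c (central m))))
    (withDollar-prefix-≺ (reverse (central m)) c (reverse y))

r$-reverse-fibWord : ∀ N → suc N ≤ r$ (reverse (fibWord N))
r$-reverse-fibWord N =
  subst (_≤ r$ (reverse (fibWord N))) (length-applyUpTo (centralRotation N) (suc N))
    (runs-BWT-≥ _ chain increasing rotation alternating)
  where
  chain : List (List ℕ)
  chain = applyUpTo (centralRotation N) (suc N)
  increasing : AllPairs _≺_ chain
  increasing = Linked⇒AllPairs ≺-trans (Linkedₚ.applyUpTo⁺₁ (centralRotation N) (suc N)
    (λ i+1<N+1 → centralRotation-≺ (s≤s⁻¹ i+1<N+1)))
  rotation : All (_∈ rotations (withDollar (reverse (fibWord N)))) chain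
  rotation =
    Allₚ.applyUpTo⁺₁ (centralRotation N) (suc N) (λ i<N+1 → centralRotation-∈ (s≤s⁻¹ i<N+1))
  alternating : Linked (_≢_ on lastOr0) chain
  alternating = Linkedₚ.applyUpTo⁺₁ (centralRotation N) (suc N) λ {i} i+1<N+1 same-last →
    alt-≢ i (toℕ-injective (suc-injective (begin
      suc (toℕ (alt i))                   ≡⟨ lastOr0-centralRotation (<⇒≤ (s≤s⁻¹ i+1<N+1)) ⟨
      lastOr0 (centralRotation N i)       ≡⟨ same-last ⟩
      lastOr0 (centralRotation N (suc i)) ≡⟨ lastOr0-centralRotation (s≤s⁻¹ i+1<N+1) ⟩
      suc (toℕ (alt (suc i)))             ∎)))
    where open ≡-Reasoning

length-fibWord-> : ∀ j → j < length (fibWord j)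
length-fibWord-> 0             = z<s
length-fibWord-> 1             = s<s z<s
length-fibWord-> (suc (suc j)) = begin-strict
  suc (suc j)                                     ≤⟨ length-fibWord-> (suc j) ⟩
  length (fibWord (suc j))                        <⟨ m<m+n _ (≤-trans z<s (length-fibWord-> j)) ⟩
  length (fibWord (suc j)) + length (fibWord j)   ≡⟨ length-++ (fibWord (suc j)) ⟨
  length (fibWord (suc (suc j)))                  ∎
  where open ≤-Reasoning

length-fibWord-≤ : ∀ j → length (fibWord j) ≤ 2 ^ suc j
length-fibWord-≤ 0             = ≤-refl
length-fibWord-≤ 1             = s≤s (s≤s (s≤s z≤n))
length-fibWord-≤ (suc (suc j)) = begin
  length (fibWord (suc j) ++ fibWord j)           ≡⟨ length-++ (fibWord (suc j)) ⟩
  length (fibWord (suc j)) + length (fibWord j)   ≤⟨ +-mono-≤ (length-fibWord-≤ (suc j))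
                                                       (≤-trans (length-fibWord-≤ j)
                                                                (^-monoʳ-≤ 2 (n≤1+n (suc j)))) ⟩
  2 ^ suc (suc j) + 2 ^ suc (suc j)               ≡⟨ cong (2 ^ suc (suc j) +_) (+-identityʳ _) ⟨
  2 ^ suc (suc (suc j))                           ∎
  where open ≤-Reasoning

⌊log₂⌋-length-fibWord : ∀ j → ⌊log₂ (length (fibWord j)) ⌋ ≤ suc j
⌊log₂⌋-length-fibWord j =
  ≤-trans (⌊log₂⌋-mono-≤ (length-fibWord-≤ j)) (≤-reflexive (⌊log₂[2^n]⌋≡n (suc j)))

propositionA1 : ∃[ σ ] ∃[ c ] ((N : ℕ) →
                  Σ (List (Fin σ)) λ w →
                    (N ≤ length w) × (⌊log₂ (length w) ⌋ * r$ w ≤ c * r$ (reverse w)))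
propositionA1 = 2 , 4 , λ N →
  fibWord (1 + 2 * N) , long N , log-ratio (1 + 2 * N) (clustered-fibWord-odd N)
  where
  long : ∀ N → N ≤ length (fibWord (1 + 2 * N))
  long N = ≤-trans (≤-trans (m≤m+n N (N + 0)) (n≤1+n _)) (<⇒≤ (length-fibWord-> (1 + 2 * N)))
  log-ratio : ∀ M → Clustered (fibWord M) →
              ⌊log₂ (length (fibWord M)) ⌋ * r$ (fibWord M) ≤ 4 * r$ (reverse (fibWord M))
  log-ratio M clustered = begin
    ⌊log₂ (length (fibWord M)) ⌋ * r$ (fibWord M) ≤⟨ *-mono-≤ (⌊log₂⌋-length-fibWord M)
                                                               (r$-clustered clustered) ⟩
    suc M * 4                                      ≡⟨ *-comm (suc M) 4 ⟩
    4 * suc M                                      ≤⟨ *-monoʳ-≤ 4 (r$-reverse-fibWord M) ⟩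
    4 * r$ (reverse (fibWord M))                   ∎
    where open ≤-Reasoning
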